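{- For every formula $\phi$ of $\mathrm{PL}(\textsc{ne})$ and every team $t$ with domain $\supseteq\mathsf{P}(\phi)$: if $t\models\phi$, then there exists $s\subseteq t$ such that $s\models\phi$ and $|s|\leq|\phi|_{\textsc{ne}}$, where $|\phi|_{\textsc{ne}}$ is the number of occurrences of $\textsc{ne}$ in $\phi$.
   Context: Fix a countably infinite set $\mathsf{Prop}$ of propositional variables. Formulas of $\mathrm{PL}(\textsc{ne})$ are generated by $\phi::=p\mid\neg p\mid\bot\mid\top\mid\textsc{ne}\mid\phi\wedge\phi\mid\phi\vee\phi$ with $p\in\mathsf{Prop}$. $\mathsf{P}(\phi)$ is the set of variables occurring in $\phi$. For $\mathsf{X}\subseteq\mathsf{Prop}$, a team with domain $\mathsf{X}$ is a set $t\subseteq 2^{\mathsf{X}}$ of valuations; $|t|$ is its cardinality. Team satisfaction: $t\models p$ iff $v(p)=1$ for all $v\in t$; $t\models\neg p$ iff $v(p)=0$ for all $v\in t$; $t\models\bot$ iff $t=\emptyset$; $t\models\top$ always; $t\models\phi\wedge\psi$ iff $t\models\phi$ and $t\models\psi$; $t\models\phi\vee\psi$ iff there are $s,u\subseteq t$ with $t=s\cup u$, $s\models\phi$, $u\models\psi$; $t\models\textsc{ne}$ iff $t\neq\emptyset$. -}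

module Defs where

open import Data.Nat using (ℕ; _+_)
open import Data.Bool using (Bool; true; false; T)
open import Data.List using (List; []; _∷_; _++_)
open import Data.Product using (Σ; _×_; ∃; ∃-syntax)
open import Data.Sum using (_⊎_)
open import Data.Unit using (⊤)
open import Data.Empty using (⊥)
open import Relation.Nullary using (¬_)
open import Relation.Binary.PropositionalEquality using (_≡_)
open import Level using (Lift; suc; zero)

data Form : Set where
  var  : ℕ → Form
  nvar : ℕ → Form
  bot  : Form
  top  : Form
  NE   : Form
  _∧ᶠ_ : Form → Form → Form
  _∨ᶠ_ : Form → Form → Form

vars : Form → List ℕ
vars (var p)  = p ∷ []
vars (nvar p) = p ∷ []
vars bot      = []
vars top      = []
vars NE       = []
vars (φ ∧ᶠ ψ) = vars φ ++ vars ψ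
vars (φ ∨ᶠ ψ) = vars φ ++ vars ψ

neCount : Form → ℕ
neCount NE       = 1
neCount (φ ∧ᶠ ψ) = neCount φ + neCount ψ
neCount (φ ∨ᶠ ψ) = neCount φ + neCount ψ
neCount _        = 0

Domain : Set
Domain = ℕ → Bool

-- Valuations on X: elements of 2^X.
Val : Domain → Set
Val X = (p : ℕ) → T (X p) → Bool

Team : Domain → Set₁
Team X = Val X → Set

_⊆ᵗ_ : {X : Domain} → Team X → Team X → Set
s ⊆ᵗ t = ∀ v → s v → t v

_⊨_ : {X : Domain} → Team X → Form → Set₁
_⊨_ {X} t (var p)  = Lift (suc zero) (∀ v → t v → (x : T (X p)) → v p x ≡ true)
_⊨_ {X} t (nvar p) = Lift (suc zero) (∀ v → t v → (x : T (X p)) → v p x ≡ false)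
t ⊨ bot    = Lift (suc zero) (∀ v → ¬ t v)
t ⊨ top    = Lift (suc zero) ⊤
t ⊨ NE     = Lift (suc zero) (∃ λ v → t v)
t ⊨ (φ ∧ᶠ ψ) = (t ⊨ φ) × (t ⊨ ψ)
_⊨_ {X} t (φ ∨ᶠ ψ) =
  Σ (Team X) λ s → Σ (Team X) λ u →
    (s ⊆ᵗ t) × (u ⊆ᵗ t) × (∀ v → t v → s v ⊎ u v) × (s ⊨ φ) × (u ⊨ ψ)

{-# OPTIONS --safe #-}
module Submission where

-- Every PL(NE) formula is union closed and convex.  By induction on φ, a
-- satisfying team t contains a satisfying subteam made of at most one
-- witness per occurrence of NE: for φ ∨ ψ take the union of the witness
-- subteams of the two parts of the split, for φ ∧ ψ the union of the
-- witness subteams of φ and of ψ, which satisfies both conjuncts by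
-- convexity since it lies between each witness subteam and t.

open import Defs
open import Data.Nat using (ℕ; _≤_; _+_; z≤n; s≤s)
open import Data.Nat.Properties using (+-mono-≤; ≤-reflexive; ≤-trans)
open import Data.Bool using (T)
open import Data.List using (List; length; []; _∷_; _++_)
open import Data.List.Properties using (length-++)
open import Data.List.Membership.Propositional using (_∈_)
open import Data.List.Membership.Propositional.Properties using (∈-++⁺ˡ; ∈-++⁺ʳ; ∈-++⁻)
open import Data.List.Relation.Unary.Any using (here)
open import Data.Product using (Σ; _×_; _,_; proj₁; proj₂)
open import Data.Sum using (inj₁; inj₂; _⊎_; [_,_]; map; map₂)
open import Data.Unit using (tt)
open import Function using (_∘′_)
open import Level using (lift)
open import Relation.Binary.PropositionalEquality using (refl)

private
  variable
    X : Domain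

_∪ᵗ_ : Team X → Team X → Team X
(s ∪ᵗ u) v = s v ⊎ u v

_∩ᵗ_ : Team X → Team X → Team X
(s ∩ᵗ u) v = s v × u v

listTeam : List (Val X) → Team X
listTeam l v = v ∈ l

⊆ᵗ-trans : {s u t : Team X} → s ⊆ᵗ u → u ⊆ᵗ t → s ⊆ᵗ t
⊆ᵗ-trans su ut v = ut v ∘′ su v

∪ᵗ-least : {s u t : Team X} → s ⊆ᵗ t → u ⊆ᵗ t → (s ∪ᵗ u) ⊆ᵗ t
∪ᵗ-least st ut v = [ st v , ut v ]

∪ᵗ-mono : {s s′ u u′ : Team X} → s ⊆ᵗ s′ → u ⊆ᵗ u′ → (s ∪ᵗ u) ⊆ᵗ (s′ ∪ᵗ u′)
∪ᵗ-mono ss′ uu′ v = map (ss′ v) (uu′ v)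

listTeam-++⁺ˡ : (l₁ l₂ : List (Val X)) → listTeam l₁ ⊆ᵗ listTeam (l₁ ++ l₂)
listTeam-++⁺ˡ l₁ l₂ v = ∈-++⁺ˡ

listTeam-++⁺ʳ : (l₁ l₂ : List (Val X)) → listTeam l₂ ⊆ᵗ listTeam (l₁ ++ l₂)
listTeam-++⁺ʳ l₁ l₂ v = ∈-++⁺ʳ l₁

listTeam-++⁻ : (l₁ l₂ : List (Val X)) → listTeam (l₁ ++ l₂) ⊆ᵗ (listTeam l₁ ∪ᵗ listTeam l₂)
listTeam-++⁻ l₁ l₂ v = ∈-++⁻ l₁

length-++-≤ : {A : Set} (l₁ l₂ : List A) {m n : ℕ} →
              length l₁ ≤ m → length l₂ ≤ n → length (l₁ ++ l₂) ≤ m + n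
length-++-≤ l₁ l₂ p q = ≤-trans (≤-reflexive (length-++ l₁)) (+-mono-≤ p q)

⊨-∪ : ∀ φ {s u : Team X} → s ⊨ φ → u ⊨ φ → (s ∪ᵗ u) ⊨ φ
⊨-∪ (var p)  (lift a) (lift b) = lift λ v → [ a v , b v ]
⊨-∪ (nvar p) (lift a) (lift b) = lift λ v → [ a v , b v ]
⊨-∪ bot      (lift a) (lift b) = lift λ v → [ a v , b v ]
⊨-∪ top      _        _        = lift tt
⊨-∪ NE       (lift (v , x)) _  = lift (v , inj₁ x)
⊨-∪ (φ ∧ᶠ ψ) (a₁ , a₂) (b₁ , b₂) = ⊨-∪ φ a₁ b₁ , ⊨-∪ ψ a₂ b₂
⊨-∪ (φ ∨ᶠ ψ) (s₁ , s₂ , s₁s , s₂s , s⊆ , a₁ , a₂) (u₁ , u₂ , u₁u , u₂u , u⊆ , b₁ , b₂) =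
  s₁ ∪ᵗ u₁ , s₂ ∪ᵗ u₂ , ∪ᵗ-mono s₁s u₁u , ∪ᵗ-mono s₂s u₂u ,
  (λ v → [ map inj₁ inj₁ ∘′ s⊆ v , map inj₂ inj₂ ∘′ u⊆ v ]) ,
  ⊨-∪ φ a₁ b₁ , ⊨-∪ ψ a₂ b₂

⊨-convex : ∀ φ {s u t : Team X} → s ⊆ᵗ u → u ⊆ᵗ t → s ⊨ φ → t ⊨ φ → u ⊨ φ
⊨-convex (var p)  _  ut _ (lift b) = lift λ v x → b v (ut v x)
⊨-convex (nvar p) _  ut _ (lift b) = lift λ v x → b v (ut v x)
⊨-convex bot      _  ut _ (lift b) = lift λ v x → b v (ut v x)
⊨-convex top      _  _  _ _        = lift tt
⊨-convex NE       su _  (lift (v , x)) _ = lift (v , su v x)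
⊨-convex (φ ∧ᶠ ψ) su ut (a₁ , a₂) (b₁ , b₂) = ⊨-convex φ su ut a₁ b₁ , ⊨-convex ψ su ut a₂ b₂
⊨-convex (φ ∨ᶠ ψ) {u = u} su ut (s₁ , s₂ , s₁s , s₂s , _ , a₁ , a₂) (t₁ , t₂ , _ , _ , t⊆ , b₁ , b₂) =
  u₁ , u₂ , ∪ᵗ-least (⊆ᵗ-trans s₁s su) (λ v → proj₂) , ∪ᵗ-least (⊆ᵗ-trans s₂s su) (λ v → proj₂) ,
  (λ v x → map (λ y → inj₂ (y , x)) (λ y → inj₂ (y , x)) (t⊆ v (ut v x))) ,
  ⊨-convex φ (λ v → inj₁) (λ v → map₂ proj₁) a₁ (⊨-∪ φ a₁ b₁) ,
  ⊨-convex ψ (λ v → inj₁) (λ v → map₂ proj₁) a₂ (⊨-∪ ψ a₂ b₂)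
  where
  -- The part of u below tᵢ is added to sᵢ; this stays between sᵢ and sᵢ ∪ tᵢ.
  u₁ u₂ : Team _
  u₁ = s₁ ∪ᵗ (t₁ ∩ᵗ u)
  u₂ = s₂ ∪ᵗ (t₂ ∩ᵗ u)

++-subteam : {t : Team X} (l₁ l₂ : List (Val X)) →
             listTeam l₁ ⊆ᵗ t → listTeam l₂ ⊆ᵗ t → listTeam (l₁ ++ l₂) ⊆ᵗ t
++-subteam l₁ l₂ l₁t l₂t = ⊆ᵗ-trans (listTeam-++⁻ l₁ l₂) (∪ᵗ-least l₁t l₂t)

small-subteam : ∀ φ {t : Team X} → t ⊨ φ →
                Σ (List (Val X)) λ l → (length l ≤ neCount φ) × (listTeam l ⊆ᵗ t) × (listTeam l ⊨ φ)
small-subteam (var p)  _ = [] , z≤n , (λ v ()) , lift λ v ()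
small-subteam (nvar p) _ = [] , z≤n , (λ v ()) , lift λ v ()
small-subteam bot      _ = [] , z≤n , (λ v ()) , lift λ v ()
small-subteam top      _ = [] , z≤n , (λ v ()) , lift tt
small-subteam NE (lift (v , x)) = v ∷ [] , s≤s z≤n , (λ { w (here refl) → x }) , lift (v , here refl)
small-subteam (φ ∧ᶠ ψ) {t} (a , b) with small-subteam φ a | small-subteam ψ b
... | l₁ , n₁ , l₁t , h₁ | l₂ , n₂ , l₂t , h₂ =
  l₁ ++ l₂ , length-++-≤ l₁ l₂ n₁ n₂ , lt ,
  ⊨-convex φ (listTeam-++⁺ˡ l₁ l₂) lt h₁ a ,
  ⊨-convex ψ (listTeam-++⁺ʳ l₁ l₂) lt h₂ b
  where
  lt : listTeam (l₁ ++ l₂) ⊆ᵗ t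
  lt = ++-subteam l₁ l₂ l₁t l₂t
small-subteam (φ ∨ᶠ ψ) (s , u , st , ut , _ , a , b) with small-subteam φ a | small-subteam ψ b
... | l₁ , n₁ , l₁s , h₁ | l₂ , n₂ , l₂u , h₂ =
  l₁ ++ l₂ , length-++-≤ l₁ l₂ n₁ n₂ , ++-subteam l₁ l₂ (⊆ᵗ-trans l₁s st) (⊆ᵗ-trans l₂u ut) ,
  listTeam l₁ , listTeam l₂ , listTeam-++⁺ˡ l₁ l₂ , listTeam-++⁺ʳ l₁ l₂ , listTeam-++⁻ l₁ l₂ , h₁ , h₂

-- Atoms over variables outside the domain hold vacuously in this encoding.
lemma3 : (φ : Form) (X : Domain) (t : Team X)
           → (∀ p → p ∈ vars φ → T (X p))
           → t ⊨ φ
           → Σ (List (Val X)) λ l →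
               (length l ≤ neCount φ) × (∀ v → v ∈ l → t v) × ((λ v → v ∈ l) ⊨ φ)
lemma3 φ X t _ = small-subteam φ
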